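{- For all integers $n,m\geqslant 0$, there is a bijection between the set of maximal chains in the poset $\Sigma_mC^n_m$ and the set of walks of length $(n+1)m$ in $C^n_m=\{0,\dots,m\}^n$ that start and end at $(0,\dots,0)$ and use only the steps $(1,1,\dots,1)$, $(-1,0,\dots,0)$, $(0,-1,\dots,0)$, $\dots$, $(0,0,\dots,-1)$.
   Context: $C_r$ is the chain $\{0<1<\dots<r\}$ and $C^n_r$ its $n$-th cartesian power with componentwise order. For fixed $n$, consider the sequence $C^n_0\to C^n_1\to\dots\to C^n_m$ where each map $C^n_r\to C^n_{r+1}$ is the coordinatewise inclusion (induced by including $C_r$ as the down-set $\{0,\dots,r\}$ of $C_{r+1}$). $\Sigma_mC^n_m$ is the stacking (lax sum) of this sequence: the poset of pairs $(x,j)$ with $0\leqslant j\leqslant m$, $x\in C^n_j$, ordered by $(x,j)\leqslant(y,l)$ iff $j\leqslant l$ and $x\leqslant y$ in $C^n_l$. A walk in $C^n_m$ is a sequence of points of $\{0,\dots,m\}^n$ in which consecutive points differ by one of the allowed steps. -}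

module Defs where

open import Data.Nat using (ℕ; zero; suc; _+_; _*_; _≤_)
open import Data.Fin using (Fin)
open import Data.Vec using (Vec; replicate; map; head; last; toList; _[_]%=_)
open import Data.Vec.Relation.Unary.All using (All)
open import Data.Vec.Relation.Binary.Pointwise.Inductive using (Pointwise)
open import Data.List using (List)
open import Data.List.Membership.Propositional using (_∈_)
open import Data.List.Relation.Unary.Linked using (Linked)
open import Data.Product using (_×_; ∃; proj₁; proj₂)
open import Data.Sum using (_⊎_)
open import Data.Refinement using (Refinement-syntax; value)
open import Relation.Binary.PropositionalEquality using (_≡_; _≢_)

Pt : ℕ → Set
Pt n = Vec ℕ n × ℕ

-- Elements of Σ_m C^n_m : pairs (x , j) with j ≤ m and x ∈ C^n_j = {0,…,j}^n.
-- (proofs are irrelevant, so elements are determined by (x , j))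
Elem : ℕ → ℕ → Set
Elem n m = [ p ∈ Pt n ∣ (proj₂ p ≤ m × All (_≤ proj₂ p) (proj₁ p)) ]

-- (x , j) ≤ (y , l) iff j ≤ l and x ≤ y componentwise (the inclusions
-- C^n_j → C^n_l are the identity on coordinates).
_≼_ : ∀ {n m} → Elem n m → Elem n m → Set
a ≼ b = proj₂ (value a) ≤ proj₂ (value b)
      × Pointwise _≤_ (proj₁ (value a)) (proj₁ (value b))

_≺_ : ∀ {n m} → Elem n m → Elem n m → Set
a ≺ b = a ≼ b × a ≢ b

-- A (finite) chain of the finite poset Σ_m C^n_m, represented canonically
-- as the list of its elements in strictly increasing order.
IsChain : ∀ {n m} → List (Elem n m) → Set
IsChain = Linked _≺_

IsMaximalChain : ∀ {n m} → List (Elem n m) → Set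
IsMaximalChain {n} {m} c =
  IsChain c ×
  ((c' : List (Elem n m)) → IsChain c' → (∀ z → z ∈ c → z ∈ c') → ∀ z → z ∈ c' → z ∈ c)

MaxChain : ℕ → ℕ → Set
MaxChain n m = [ c ∈ List (Elem n m) ∣ IsMaximalChain c ]

-- Allowed steps: +(1,…,1) or −e_i.
Step : ∀ {n} → Vec ℕ n → Vec ℕ n → Set
Step {n} x y = (y ≡ map suc x) ⊎ ∃ λ (i : Fin n) → x ≡ (y [ i ]%= suc)

-- Walks of length (n+1)m in C^n_m = {0,…,m}^n from (0,…,0) to (0,…,0):
-- sequences of (n+1)m+1 points, consecutive ones differing by an allowed step.
IsWalk : (n m : ℕ) → Vec (Vec ℕ n) (suc (suc n * m)) → Set
IsWalk n m w =
  All (All (_≤ m)) w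
  × head w ≡ replicate n 0
  × last w ≡ replicate n 0
  × Linked Step (toList w)

Walk : ℕ → ℕ → Set
Walk n m = [ w ∈ Vec (Vec ℕ n) (suc (suc n * m)) ∣ IsWalk n m w ]

-- Σ_m C^n_m is graded by rank (x , j) = j + Σᵢ xᵢ, with bottom (0 , 0) and top ((m,…,m) , m), and
-- its covers are (x , j) ⋖ (x , j+1) and (x , j) ⋖ (x + eᵢ , j). Hence its maximal chains are exactly
-- the saturated chains from bottom to top, all of length (n+1)m. The map (x , j) ↦ (j,…,j) − x sends
-- covers of the first kind to the step (1,…,1), those of the second kind to −eᵢ, and bottom and top
-- to 0. Conversely a walk determines the levels j, which increase exactly at the steps (1,…,1).

module Submission where

open import Defs
open import Level using (0ℓ)
open import Function using (_∘_; _on_; id)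
open import Data.Nat as ℕ using (ℕ; zero; suc; _+_; _*_; _∸_; z≤n; s≤s)
open import Data.Nat.Properties as ℕₚ
  using ( +-identityʳ; +-suc; 1+n≢n; ≰⇒>; ≤-reflexive; ≤-pred; +-cancelʳ-≤; +-cancelˡ-≤
        ; +-monoʳ-≤; +-monoˡ-≤; +-mono-≤; ≤∧≢⇒<; n≤1+n; m∸n≤m; m∸[m∸n]≡n; +-∸-assoc; n∸n≡0
        ; m∸n≡0⇒m≤n; *-cancelˡ-≡; *-zeroʳ)
open import Data.Fin using (zero; suc)
open import Data.Vec using (Vec; []; _∷_; replicate; map; sum; last; toList; fromList; cast; _[_]%=_)
import Data.Vec.Properties as Vecₚ
open import Data.Vec.Relation.Unary.All as VAll using ([]; _∷_) renaming (All to VAll)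
import Data.Vec.Relation.Unary.All.Properties as VAllₚ
open import Data.Vec.Relation.Binary.Pointwise.Inductive as Pointwise using (Pointwise; []; _∷_)
open import Data.List as List using (List; []; _∷_; length)
import Data.List.Properties as Listₚ
import Data.List.Relation.Unary.All.Properties as Allₚ
open import Data.List.Membership.Propositional using (_∈_)
open import Data.List.Relation.Binary.Subset.Propositional using (_⊆_)
open import Data.List.Relation.Unary.Any using (here; there)
open import Data.List.Relation.Unary.All as All using (All; []; _∷_)
open import Data.List.Relation.Unary.Linked as Linked using (Linked; []; [-]; _∷_)
import Data.List.Relation.Unary.Linked.Properties as Linkedₚ
open import Data.Product using (_×_; _,_; ∃; proj₁; proj₂)
import Data.Product.Properties as Productₚ
open import Data.Sum using (_⊎_; inj₁; inj₂)
open import Data.Empty using (⊥-elim)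
open import Data.Refinement using (value; _,_)
import Data.Refinement.Properties as Refinementₚ
open import Data.Irrelevant using ([_])
open import Relation.Binary using (Rel; Reflexive; Transitive; Decidable; DecidableEquality; IsPartialOrder)
open import Relation.Nullary using (Dec; yes; no; _×-dec_)
open import Relation.Nullary.Decidable using (recompute)
open import Relation.Binary.PropositionalEquality hiding ([_])
open import Function.Bundles using (_⤖_; mk↔ₛ′)
open import Function.Properties.Inverse using (↔⇒⤖)

lastOr : ∀ {A : Set} → A → List A → A
lastOr a []      = a
lastOr _ (b ∷ t) = lastOr b t

lastOr-map : ∀ {A B : Set} (f : A → B) a t → lastOr (f a) (List.map f t) ≡ f (lastOr a t)
lastOr-map f a []      = refl
lastOr-map f _ (b ∷ t) = lastOr-map f b t

All-lastOr : ∀ {A : Set} {P : A → Set} {a} t → All P (a ∷ t) → P (lastOr a t)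
All-lastOr []      (pa ∷ [])  = pa
All-lastOr (_ ∷ t) (_ ∷ pbt) = All-lastOr t pbt

Linked-≤-lastOr : ∀ {A : Set} {R : Rel A 0ℓ} → Reflexive R → Transitive R →
                  ∀ {a} t → Linked R (a ∷ t) → All (λ x → R x (lastOr a t)) (a ∷ t)
Linked-≤-lastOr R-refl R-trans []      _          = R-refl ∷ []
Linked-≤-lastOr R-refl R-trans (_ ∷ t) (aRb ∷ bt) with Linked-≤-lastOr R-refl R-trans t bt
... | bRe ∷ tRe = R-trans aRb bRe ∷ bRe ∷ tRe

Linked-height : ∀ {A : Set} {R : Rel A 0ℓ} (h : A → ℕ) → (∀ {a b} → R a b → h b ≡ suc (h a)) →
                ∀ {a} t → Linked R (a ∷ t) → h (lastOr a t) ≡ h a + length t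
Linked-height h step {a} [] _ = sym (+-identityʳ (h a))
Linked-height h step {a} (b ∷ t) (aRb ∷ bt) = begin
  h (lastOr b t)        ≡⟨ Linked-height h step t bt ⟩
  h b + length t        ≡⟨ cong (_+ length t) (step aRb) ⟩
  suc (h a) + length t  ≡⟨ sym (+-suc (h a) (length t)) ⟩
  h a + length (b ∷ t)  ∎
  where open ≡-Reasoning

module Chains {E : Set} {_≤_ : Rel E 0ℓ} (isPartialOrder : IsPartialOrder _≡_ _≤_)
              (_≟_ : DecidableEquality E) (_≤?_ : Decidable _≤_) where

  open IsPartialOrder isPartialOrder using (antisym) renaming (refl to ≤-refl; trans to ≤-trans)

  _<_ : Rel E 0ℓ
  a < b = a ≤ b × a ≢ b

  <-trans : Transitive _<_
  <-trans (a≤b , a≢b) (b≤c , _) = ≤-trans a≤b b≤c , λ { refl → a≢b (antisym a≤b b≤c) }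

  Chain : List E → Set
  Chain = Linked _<_

  Maximal : List E → Set
  Maximal c = Chain c × ((c' : List E) → Chain c' → (∀ z → z ∈ c → z ∈ c') → ∀ z → z ∈ c' → z ∈ c)

  Comparable : E → List E → Set
  Comparable z c = ∀ {y} → y ∈ c → y ≤ z ⊎ z ≤ y

  chain-increasing : ∀ {a t} → Chain (a ∷ t) → All (a <_) t
  chain-increasing [-]        = []
  chain-increasing (a<b ∷ bt) = Linkedₚ.Linked⇒All <-trans a<b bt

  chain-∷ : ∀ {a t} → All (a <_) t → Chain t → Chain (a ∷ t)
  chain-∷ []        _  = [-]
  chain-∷ (a<b ∷ _) bt = a<b ∷ bt

  chain-comparable : ∀ {c} → Chain c → ∀ {z} → z ∈ c → Comparable z c
  chain-comparable ch (here refl) (here refl) = inj₁ ≤-refl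
  chain-comparable ch (here refl) (there q)   = inj₂ (proj₁ (All.lookup (chain-increasing ch) q))
  chain-comparable ch (there p)   (here refl) = inj₁ (proj₁ (All.lookup (chain-increasing ch) p))
  chain-comparable ch (there p)   (there q)   = chain-comparable (Linked.tail ch) p q

  chain-∈-min : ∀ {a t z} → Chain (a ∷ t) → z ∈ a ∷ t → (∀ y → z ≤ y) → a ≡ z
  chain-∈-min ch (here a≡z) _   = sym a≡z
  chain-∈-min ch (there q)  min = antisym (proj₁ (All.lookup (chain-increasing ch) q)) (min _)

  chain-∈-max : ∀ {a t z} → Chain (a ∷ t) → z ∈ a ∷ t → (∀ y → y ≤ z) → lastOr a t ≡ z
  chain-∈-max {t = []}    _                 (here a≡z)  _   = sym a≡z
  chain-∈-max {t = b ∷ _} ((a≤b , a≢b) ∷ _) (here refl) max = ⊥-elim (a≢b (antisym a≤b (max b)))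
  chain-∈-max {t = b ∷ _} (_ ∷ bt)          (there q)   max = chain-∈-max bt q max

  insert : ∀ z c → Chain c → Comparable z c → ∃ λ c' → Chain c' × z ∷ c ⊆ c' × c' ⊆ z ∷ c
  insert z []      _  _   = z ∷ [] , [-] , id , id
  insert z (y ∷ c) ch cmp with y ≤? z | cmp (here refl)
  ... | no y≰z | inj₁ y≤z = ⊥-elim (y≰z y≤z)
  ... | no y≰z | inj₂ z≤y = z ∷ y ∷ c , (z≤y , λ { refl → y≰z ≤-refl }) ∷ ch , id , id
  ... | yes y≤z | _ with z ≟ y
  ...   | yes refl = y ∷ c , ch , (λ { (here refl) → here refl ; (there p) → p }) , there
  ...   | no z≢y with insert z c (Linked.tail ch) (cmp ∘ there)
  ...     | c' , ch' , z∷c⊆c' , c'⊆z∷c =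
    y ∷ c' , chain-∷ (All.tabulate (y<_ ∘ c'⊆z∷c)) ch' , ⊇′ , ⊆′
    where
    y<_ : ∀ {w} → w ∈ z ∷ c → y < w
    y< here refl = y≤z , z≢y ∘ sym
    y< there q   = All.lookup (chain-increasing ch) q
    ⊇′ : z ∷ y ∷ c ⊆ y ∷ c'
    ⊇′ (here refl)         = there (z∷c⊆c' (here refl))
    ⊇′ (there (here refl)) = here refl
    ⊇′ (there (there q))   = there (z∷c⊆c' (there q))
    ⊆′ : y ∷ c' ⊆ z ∷ y ∷ c
    ⊆′ (here refl) = there (here refl)
    ⊆′ (there p) with c'⊆z∷c p
    ... | here refl = here refl
    ... | there q   = there (there q)

  maximal-∋ : ∀ {c} → Maximal c → ∀ {z} → Comparable z c → z ∈ c
  maximal-∋ {c} (ch , max) {z} cmp with insert z c ch cmp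
  ... | c' , ch' , z∷c⊆c' , _ = max c' ch' (λ _ → z∷c⊆c' ∘ there) z (z∷c⊆c' (here refl))

  module Graded (_⋖_ : Rel E 0ℓ) (⋖⇒≤ : ∀ {a b} → a ⋖ b → a ≤ b)
                (rank : E → ℕ) (rank-⋖ : ∀ {a b} → a ⋖ b → rank b ≡ suc (rank a))
                (≤-rank-antisym : ∀ {a b} → a ≤ b → rank b ℕ.≤ rank a → a ≡ b)
                (⋖-below : ∀ {a b} → a < b → ∃ λ a' → a ⋖ a' × a' ≤ b)
                (bot top : E) (bot-min : ∀ a → bot ≤ a) (top-max : ∀ a → a ≤ top) where

    ⋖⇒< : ∀ {a b} → a ⋖ b → a < b
    ⋖⇒< a⋖b = ⋖⇒≤ a⋖b , λ { refl → 1+n≢n (sym (rank-⋖ a⋖b)) }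

    data Saturated : List E → Set where
      saturated : ∀ {a t} → a ≡ bot → Linked _⋖_ (a ∷ t) → lastOr a t ≡ top → Saturated (a ∷ t)

    -- If every element of c is either ≤ a or in t, then a cover a' of a below the successor
    -- b of a is comparable with all of c, hence in c, which forces a' = b.
    maximal-⋖ : ∀ {c} → Maximal c → ∀ {a t} → Chain (a ∷ t) → (∀ {y} → y ∈ c → y ≤ a ⊎ y ∈ t) →
                Linked _⋖_ (a ∷ t)
    maximal-⋖ mc {t = []}    _          _     = [-]
    maximal-⋖ mc {a} {b ∷ t} (a<b ∷ bt) split with ⋖-below a<b
    ... | a' , a⋖a' , a'≤b = a⋖b ∷ maximal-⋖ mc bt split′
      where
      a<a' : a < a'
      a<a' = ⋖⇒< a⋖a'
      b≤ : ∀ {y} → y ∈ t → b ≤ y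
      b≤ = proj₁ ∘ All.lookup (chain-increasing bt)
      comparable : Comparable a' _
      comparable y∈c with split y∈c
      ... | inj₁ y≤a         = inj₁ (≤-trans y≤a (proj₁ a<a'))
      ... | inj₂ (here refl) = inj₂ a'≤b
      ... | inj₂ (there q)   = inj₂ (≤-trans a'≤b (b≤ q))
      a⋖b : a ⋖ b
      a⋖b with split (maximal-∋ mc comparable)
      ... | inj₁ a'≤a        = ⊥-elim (proj₂ a<a' (antisym (proj₁ a<a') a'≤a))
      ... | inj₂ (here refl) = a⋖a'
      ... | inj₂ (there q)   = ⊥-elim (proj₂ (All.lookup (chain-increasing bt) q) (antisym (b≤ q) a'≤b))
      split′ : ∀ {y} → y ∈ _ → y ≤ b ⊎ y ∈ t
      split′ y∈c with split y∈c
      ... | inj₁ y≤a         = inj₁ (≤-trans y≤a (proj₁ a<b))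
      ... | inj₂ (here refl) = inj₁ ≤-refl
      ... | inj₂ (there q)   = inj₂ q

    maximal⇒saturated : ∀ {c} → Maximal c → Saturated c
    maximal⇒saturated {[]} mc with maximal-∋ mc {bot} (λ ())
    ... | ()
    maximal⇒saturated {a ∷ t} mc@(ch , _) = saturated
      (chain-∈-min ch (maximal-∋ mc (λ {y} _ → inj₂ (bot-min y))) bot-min)
      (maximal-⋖ mc ch λ { (here refl) → inj₁ ≤-refl ; (there q) → inj₂ q })
      (chain-∈-max ch (maximal-∋ mc (λ {y} _ → inj₁ (top-max y))) top-max)

    -- Between a and its successor b on a cover path there is no room: z lies at rank ≤ rank a,
    -- hence is a, or at rank ≥ rank b, hence is b.
    cover-path-∋ : ∀ {a t z} → Linked _⋖_ (a ∷ t) → a ≤ z → z ≤ lastOr a t → Comparable z t → z ∈ a ∷ t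
    cover-path-∋ {t = []}    _            a≤z z≤a _   = here (antisym z≤a a≤z)
    cover-path-∋ {a} {b ∷ t} {z} (a⋖b ∷ bt) a≤z z≤e cmp with cmp (here refl)
    ... | inj₁ b≤z = there (cover-path-∋ bt b≤z z≤e (cmp ∘ there))
    ... | inj₂ z≤b with rank z ℕ.≤? rank a
    ...   | yes rz≤ra = here (sym (≤-rank-antisym a≤z rz≤ra))
    ...   | no  rz≰ra =
      there (here (≤-rank-antisym z≤b (subst (ℕ._≤ rank z) (sym (rank-⋖ a⋖b)) (≰⇒> rz≰ra))))

    saturated⇒maximal : ∀ {c} → Saturated c → Maximal c
    saturated⇒maximal (saturated refl cov end) = Linked.map ⋖⇒< cov , λ c' ch' c⊆c' z z∈c' →
      cover-path-∋ cov (bot-min z) (subst (z ≤_) (sym end) (top-max z))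
                   (λ y∈t → chain-comparable ch' z∈c' (c⊆c' _ (there y∈t)))

_≤ᵛ_ : ∀ {n} → Vec ℕ n → Vec ℕ n → Set
_≤ᵛ_ = Pointwise ℕ._≤_

+-≤-squeeze : ∀ {a b c d} → a ℕ.≤ b → c ℕ.≤ d → b + d ℕ.≤ a + c → a ≡ b × c ≡ d
+-≤-squeeze {a} {b} {c} {d} a≤b c≤d b+d≤a+c =
  ℕₚ.≤-antisym a≤b (+-cancelʳ-≤ d b a (ℕₚ.≤-trans b+d≤a+c (+-monoʳ-≤ a c≤d))) ,
  ℕₚ.≤-antisym c≤d (+-cancelˡ-≤ b d c (ℕₚ.≤-trans b+d≤a+c (+-monoˡ-≤ c a≤b)))

sum-mono-≤ᵛ : ∀ {n} {x y : Vec ℕ n} → x ≤ᵛ y → sum x ℕ.≤ sum y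
sum-mono-≤ᵛ []         = z≤n
sum-mono-≤ᵛ (u≤v ∷ xy) = +-mono-≤ u≤v (sum-mono-≤ᵛ xy)

≤ᵛ-sum-antisym : ∀ {n} {x y : Vec ℕ n} → x ≤ᵛ y → sum y ℕ.≤ sum x → x ≡ y
≤ᵛ-sum-antisym []         _  = refl
≤ᵛ-sum-antisym (u≤v ∷ xy) le with +-≤-squeeze u≤v (sum-mono-≤ᵛ xy) le
... | refl , sx≡sy = cong (_ ∷_) (≤ᵛ-sum-antisym xy (≤-reflexive (sym sx≡sy)))

≤ᵛ-≢⇒[]%=suc : ∀ {n} {x y : Vec ℕ n} → x ≤ᵛ y → x ≢ y → ∃ λ i → (x [ i ]%= suc) ≤ᵛ y
≤ᵛ-≢⇒[]%=suc []                   x≢y = ⊥-elim (x≢y refl)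
≤ᵛ-≢⇒[]%=suc {x = u ∷ _} {v ∷ _} (u≤v ∷ xy) x≢y with u ℕ.≟ v
... | no u≢v    = zero , ≤∧≢⇒< u≤v u≢v ∷ xy
... | yes refl with ≤ᵛ-≢⇒[]%=suc xy (x≢y ∘ cong (u ∷_))
...   | i , xᵢ≤y = suc i , ℕₚ.≤-refl ∷ xᵢ≤y

≤ᵛ-[]%=suc : ∀ {n} (x : Vec ℕ n) i → x ≤ᵛ (x [ i ]%= suc)
≤ᵛ-[]%=suc (u ∷ x) zero    = n≤1+n u ∷ Pointwise.refl ℕₚ.≤-refl
≤ᵛ-[]%=suc (u ∷ x) (suc i) = ℕₚ.≤-refl ∷ ≤ᵛ-[]%=suc x i

sum-[]%=suc : ∀ {n} (x : Vec ℕ n) i → sum (x [ i ]%= suc) ≡ suc (sum x)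
sum-[]%=suc (u ∷ x) zero    = refl
sum-[]%=suc (u ∷ x) (suc i) = trans (cong (u +_) (sum-[]%=suc x i)) (+-suc u (sum x))

sum-replicate : ∀ n k → sum (replicate n k) ≡ n * k
sum-replicate zero    k = refl
sum-replicate (suc n) k = cong (k +_) (sum-replicate n k)

VAll-replicate : ∀ {P : ℕ → Set} n {k} → P k → VAll P (replicate n k)
VAll-replicate zero    _  = []
VAll-replicate (suc n) pk = pk ∷ VAll-replicate n pk

replicate-0-≤ᵛ : ∀ {n} (x : Vec ℕ n) → replicate n 0 ≤ᵛ x
replicate-0-≤ᵛ []      = []
replicate-0-≤ᵛ (_ ∷ x) = z≤n ∷ replicate-0-≤ᵛ x

≤ᵛ-replicate : ∀ {n j} {x : Vec ℕ n} → VAll (ℕ._≤ j) x → x ≤ᵛ replicate n j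
≤ᵛ-replicate []          = []
≤ᵛ-replicate (u≤j ∷ x≤j) = u≤j ∷ ≤ᵛ-replicate x≤j

≤ᵛ-VAll : ∀ {n j} {x y : Vec ℕ n} → x ≤ᵛ y → VAll (ℕ._≤ j) y → VAll (ℕ._≤ j) x
≤ᵛ-VAll []         []          = []
≤ᵛ-VAll (u≤v ∷ xy) (v≤j ∷ y≤j) = ℕₚ.≤-trans u≤v v≤j ∷ ≤ᵛ-VAll xy y≤j

InLayer : ∀ {n} → Pt n → Set
InLayer p = VAll (ℕ._≤ proj₂ p) (proj₁ p)

IsElem : ∀ {n} → ℕ → Pt n → Set
IsElem m p = proj₂ p ℕ.≤ m × InLayer p

rank : ∀ {n} → Pt n → ℕ
rank (x , j) = j + sum x

_⊑_ : ∀ {n} → Pt n → Pt n → Set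
(x , j) ⊑ (y , l) = j ℕ.≤ l × x ≤ᵛ y

⊑-refl : ∀ {n} {a : Pt n} → a ⊑ a
⊑-refl = ℕₚ.≤-refl , Pointwise.refl ℕₚ.≤-refl

⊑-trans : ∀ {n} {a b c : Pt n} → a ⊑ b → b ⊑ c → a ⊑ c
⊑-trans (j≤l , x≤y) (l≤k , y≤z) = ℕₚ.≤-trans j≤l l≤k , Pointwise.trans ℕₚ.≤-trans x≤y y≤z

⊑-rank-antisym : ∀ {n} {a b : Pt n} → a ⊑ b → rank b ℕ.≤ rank a → a ≡ b
⊑-rank-antisym (j≤l , x≤y) le with +-≤-squeeze j≤l (sum-mono-≤ᵛ x≤y) le
... | refl , sx≡sy = cong (_, _) (≤ᵛ-sum-antisym x≤y (≤-reflexive (sym sx≡sy)))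

⊑-antisym : ∀ {n} {a b : Pt n} → a ⊑ b → b ⊑ a → a ≡ b
⊑-antisym a⊑b (l≤j , y≤x) = ⊑-rank-antisym a⊑b (+-mono-≤ l≤j (sum-mono-≤ᵛ y≤x))

rank-diagonal : ∀ n j → rank (replicate n j , j) ≡ suc n * j
rank-diagonal n j = cong (j +_) (sum-replicate n j)

_⋖_ : ∀ {n} → Pt n → Pt n → Set
(x , j) ⋖ (y , l) = (y ≡ x × l ≡ suc j) ⊎ (l ≡ j × ∃ λ i → y ≡ x [ i ]%= suc)

rank-⋖ : ∀ {n} {a b : Pt n} → a ⋖ b → rank b ≡ suc (rank a)
rank-⋖             (inj₁ (refl , refl))     = refl
rank-⋖ {a = x , j} (inj₂ (refl , i , refl)) = trans (cong (j +_) (sum-[]%=suc x i)) (+-suc j (sum x))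

⋖⇒⊑ : ∀ {n} {a b : Pt n} → a ⋖ b → a ⊑ b
⋖⇒⊑             (inj₁ (refl , refl))     = n≤1+n _ , Pointwise.refl ℕₚ.≤-refl
⋖⇒⊑ {a = x , j} (inj₂ (refl , i , refl)) = ℕₚ.≤-refl , ≤ᵛ-[]%=suc x i

-- Raise the level if b is on a higher level, otherwise raise a coordinate where x is below y.
⋖-below : ∀ {n} {a b : Pt n} → a ⊑ b → a ≢ b → InLayer a → InLayer b →
          ∃ λ a' → a ⋖ a' × a' ⊑ b × InLayer a'
⋖-below {a = x , j} {y , l} (j≤l , x≤y) a≢b x≤j y≤l with suc j ℕ.≤? l
... | yes j<l =
  (x , suc j) , inj₁ (refl , refl) , (j<l , x≤y) , VAll.map (λ u≤j → ℕₚ.≤-trans u≤j (n≤1+n j)) x≤j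
... | no  j≮l with ℕₚ.≤-antisym j≤l (≤-pred (≰⇒> j≮l))
...   | refl with ≤ᵛ-≢⇒[]%=suc x≤y (a≢b ∘ cong (_, j))
...     | i , xᵢ≤y =
  (x [ i ]%= suc , j) , inj₂ (refl , i , refl) , (ℕₚ.≤-refl , xᵢ≤y) , ≤ᵛ-VAll xᵢ≤y y≤l

_≟ᵛ_ : ∀ {n} → DecidableEquality (Vec ℕ n)
_≟ᵛ_ = Vecₚ.≡-dec ℕ._≟_

complement : ∀ {n} → Pt n → Vec ℕ n
complement (x , j) = map (j ∸_) x

atLevel : ∀ {n} → ℕ → Vec ℕ n → Pt n
atLevel j w = map (j ∸_) w , j

map-∸-bounded : ∀ {n} j (x : Vec ℕ n) → VAll (ℕ._≤ j) (map (j ∸_) x)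
map-∸-bounded j x = VAllₚ.map⁺ (VAll.universal (m∸n≤m j) x)

map-∸-involutive : ∀ {n j} {x : Vec ℕ n} → VAll (ℕ._≤ j) x → map (j ∸_) (map (j ∸_) x) ≡ x
map-∸-involutive []          = refl
map-∸-involutive (u≤j ∷ x≤j) = cong₂ _∷_ (m∸[m∸n]≡n u≤j) (map-∸-involutive x≤j)

map-suc∸ : ∀ {n j} {x : Vec ℕ n} → VAll (ℕ._≤ j) x → map (suc j ∸_) x ≡ map suc (map (j ∸_) x)
map-suc∸ []          = refl
map-suc∸ (u≤j ∷ x≤j) = cong₂ _∷_ (+-∸-assoc 1 u≤j) (map-suc∸ x≤j)

map-∸-[]%=suc : ∀ {n} j (x : Vec ℕ n) i → VAll (ℕ._≤ j) (x [ i ]%= suc) →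
                map (j ∸_) x ≡ map (j ∸_) (x [ i ]%= suc) [ i ]%= suc
map-∸-[]%=suc j (u ∷ x) zero    (u<j ∷ _)  = cong (_∷ map (j ∸_) x) (+-∸-assoc 1 u<j)
map-∸-[]%=suc j (u ∷ x) (suc i) (_ ∷ x≤j) = cong (j ∸ u ∷_) (map-∸-[]%=suc j x i x≤j)

map-∸-replicate : ∀ n j → map (j ∸_) (replicate n j) ≡ replicate n 0
map-∸-replicate n j = trans (Vecₚ.map-replicate (j ∸_) j n) (cong (replicate n) (n∸n≡0 j))

map-suc-[]%=suc-≢ : ∀ {n} (v : Vec ℕ n) i → v ≢ map suc (v [ i ]%= suc)
map-suc-[]%=suc-≢ (u ∷ v) zero    eq = ℕₚ.<⇒≢ (ℕₚ.m<n+m u (s≤s z≤n)) (Vecₚ.∷-injectiveˡ eq)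
map-suc-[]%=suc-≢ (u ∷ v) (suc i) eq = map-suc-[]%=suc-≢ v i (Vecₚ.∷-injectiveʳ eq)

complement-bounded : ∀ {n m} {p : Pt n} → IsElem m p → VAll (ℕ._≤ m) (complement p)
complement-bounded {p = x , j} (j≤m , _) = VAll.map (λ u≤j → ℕₚ.≤-trans u≤j j≤m) (map-∸-bounded j x)

complement-0⇒replicate : ∀ {n j} {x : Vec ℕ n} → VAll (ℕ._≤ j) x → map (j ∸_) x ≡ replicate n 0 →
                         x ≡ replicate n j
complement-0⇒replicate []          _  = refl
complement-0⇒replicate (u≤j ∷ x≤j) eq =
  cong₂ _∷_ (ℕₚ.≤-antisym u≤j (m∸n≡0⇒m≤n (Vecₚ.∷-injectiveˡ eq)))
            (complement-0⇒replicate x≤j (Vecₚ.∷-injectiveʳ eq))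

complement-0⇒top : ∀ {n m} {p : Pt n} → InLayer p → complement p ≡ replicate n 0 → rank p ≡ suc n * m →
                   p ≡ (replicate n m , m)
complement-0⇒top {n} {m} {x , j} x≤j complement≡0 rank≡ with complement-0⇒replicate x≤j complement≡0
... | refl with *-cancelˡ-≡ j m (suc n) (trans (sym (rank-diagonal n j)) rank≡)
...   | refl = refl

⋖⇒Step : ∀ {n} {a b : Pt n} → InLayer a → InLayer b → a ⋖ b → Step (complement a) (complement b)
⋖⇒Step             x≤j _   (inj₁ (refl , refl))     = inj₁ (map-suc∸ x≤j)
⋖⇒Step {a = x , _} _   x≤j (inj₂ (refl , i , refl)) = inj₂ (i , map-∸-[]%=suc _ x i x≤j)

levelAfter : ∀ {n} → ℕ → {w w' : Vec ℕ n} → Dec (w' ≡ map suc w) → ℕ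
levelAfter j (yes _) = suc j
levelAfter j (no _)  = j

-- The chain over the walk w ∷ ws started at level j, without its first point atLevel j w.
above : ∀ {n} → ℕ → Vec ℕ n → List (Vec ℕ n) → List (Pt n)
above j w []        = []
above j w (w' ∷ ws) = atLevel j' w' ∷ above j' w' ws
  where j' = levelAfter j (w' ≟ᵛ map suc w)

atLevel-complement : ∀ {n} {p : Pt n} → InLayer p → atLevel (proj₂ p) (complement p) ≡ p
atLevel-complement x≤j = cong (_, _) (map-∸-involutive x≤j)

above-InLayer : ∀ {n} j (w : Vec ℕ n) ws → All InLayer (above j w ws)
above-InLayer j w []        = []
above-InLayer j w (w' ∷ ws) = map-∸-bounded _ w' ∷ above-InLayer _ w' ws

step-lifts : ∀ {n j} {w w' : Vec ℕ n} → Step w w' → VAll (ℕ._≤ j) w →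
             let j' = levelAfter j (w' ≟ᵛ map suc w) in VAll (ℕ._≤ j') w' × atLevel j w ⋖ atLevel j' w'
step-lifts {w = w} {w'} st w≤j with w' ≟ᵛ map suc w
... | yes refl = VAllₚ.map⁺ (VAll.map s≤s w≤j) , inj₁ (sym (Vecₚ.map-∘ _ suc w) , refl)
... | no w'≢suc with st
...   | inj₁ w'≡suc    = ⊥-elim (w'≢suc w'≡suc)
...   | inj₂ (i , refl) = ≤ᵛ-VAll (≤ᵛ-[]%=suc w' i) w≤j , inj₂ (refl , i , map-∸-[]%=suc _ w' i w≤j)

complement-above : ∀ {n j} {w : Vec ℕ n} {ws} → Linked Step (w ∷ ws) → VAll (ℕ._≤ j) w →
                   List.map complement (above j w ws) ≡ ws
complement-above [-]          _   = refl
complement-above (st ∷ steps) w≤j with step-lifts st w≤j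
... | w'≤j' , _ = cong₂ _∷_ (map-∸-involutive w'≤j') (complement-above steps w'≤j')

above-⋖ : ∀ {n j} {w : Vec ℕ n} {ws} → Linked Step (w ∷ ws) → VAll (ℕ._≤ j) w →
          Linked _⋖_ (atLevel j w ∷ above j w ws)
above-⋖ [-]          _   = [-]
above-⋖ (st ∷ steps) w≤j with step-lifts st w≤j
... | w'≤j' , w⋖w' = w⋖w' ∷ above-⋖ steps w'≤j'

levelAfter-⋖ : ∀ {n} {a b : Pt n} → InLayer a → InLayer b → a ⋖ b →
               levelAfter (proj₂ a) (complement b ≟ᵛ map suc (complement a)) ≡ proj₂ b
levelAfter-⋖ {a = x , j} {b} x≤j y≤l a⋖b with complement b ≟ᵛ map suc (complement (x , j)) | a⋖b
... | yes _   | inj₁ (refl , refl)     = refl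
... | yes eq  | inj₂ (refl , i , refl) =
  ⊥-elim (map-suc-[]%=suc-≢ (complement b) i (trans eq (cong (map suc) (map-∸-[]%=suc j x i y≤l))))
... | no  neq | inj₁ (refl , refl)     = ⊥-elim (neq (map-suc∸ x≤j))
... | no  _   | inj₂ (refl , _ , refl) = refl

above-complement : ∀ {n} {a : Pt n} {t} → Linked _⋖_ (a ∷ t) → All InLayer (a ∷ t) →
                   above (proj₂ a) (complement a) (List.map complement t) ≡ t
above-complement [-] _ = refl
above-complement {t = b ∷ t} (a⋖b ∷ cov) (a∈ ∷ b∈ ∷ t∈) = begin
  above _ (complement _) (List.map complement (b ∷ t))
    ≡⟨ cong (λ k → atLevel k (complement b) ∷ above k (complement b) (List.map complement t))
            (levelAfter-⋖ a∈ b∈ a⋖b) ⟩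
  atLevel (proj₂ b) (complement b) ∷ above (proj₂ b) (complement b) (List.map complement t)
    ≡⟨ cong₂ _∷_ (atLevel-complement b∈) (above-complement cov (b∈ ∷ t∈)) ⟩
  b ∷ t ∎
  where open ≡-Reasoning

chainOver : ∀ {n} → List (Vec ℕ n) → List (Pt n)
chainOver []       = []
chainOver (w ∷ ws) = atLevel 0 w ∷ above 0 w ws

chainOver-InLayer : ∀ {n} (l : List (Vec ℕ n)) → All InLayer (chainOver l)
chainOver-InLayer []       = []
chainOver-InLayer (w ∷ ws) = map-∸-bounded 0 w ∷ above-InLayer 0 w ws

data ClosedWalk (n m : ℕ) : List (Vec ℕ n) → Set where
  closedWalk : ∀ {w ws} → w ≡ replicate n 0 → All (VAll (ℕ._≤ m)) (w ∷ ws) → Linked Step (w ∷ ws) →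
               lastOr w ws ≡ replicate n 0 → length ws ≡ suc n * m → ClosedWalk n m (w ∷ ws)

last-lastOr : ∀ {A : Set} {k} (a : A) (v : Vec A k) → last (a ∷ v) ≡ lastOr a (toList v)
last-lastOr a []      = refl
last-lastOr a (b ∷ v) = last-lastOr b v

IsWalk⇒ClosedWalk : ∀ {n m} {w} → IsWalk n m w → ClosedWalk n m (toList w)
IsWalk⇒ClosedWalk {w = a ∷ v} (bounded , refl , end , steps) =
  closedWalk refl (VAllₚ.toList⁺ bounded) steps (trans (sym (last-lastOr a v)) end) (Vecₚ.length-toList v)

ClosedWalk⇒IsWalk : ∀ {n m} w → ClosedWalk n m (toList w) → IsWalk n m w
ClosedWalk⇒IsWalk (a ∷ v) (closedWalk refl bounded steps end _) =
  VAllₚ.toList⁻ bounded , refl , trans (last-lastOr a v) end , steps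

ClosedWalk-length : ∀ {n m l} → ClosedWalk n m l → length l ≡ suc (suc n * m)
ClosedWalk-length (closedWalk _ _ _ _ len) = cong suc len

toList-cast-fromList : ∀ {A : Set} {k} (l : List A) .(eq : length l ≡ k) → toList (cast eq (fromList l)) ≡ l
toList-cast-fromList l eq = trans (Vecₚ.toList-cast eq (fromList l)) (Vecₚ.toList∘fromList l)

toWalk : ∀ {n m} (l : List (Vec ℕ n)) → .(ClosedWalk n m l) → Walk n m
toWalk {n} {m} l cw = w , [ ClosedWalk⇒IsWalk w (subst (ClosedWalk _ _) (sym (toList-cast-fromList l _)) cw) ]
  where
  w : Vec (Vec ℕ n) (suc (suc n * m))
  w = cast (ClosedWalk-length cw) (fromList l)

module SigmaPoset (n m : ℕ) where

  _≟ᴾ_ : DecidableEquality (Pt n)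
  _≟ᴾ_ = Productₚ.≡-dec _≟ᵛ_ ℕ._≟_

  Elem-IsElem : (e : Elem n m) → IsElem m (value e)
  Elem-IsElem (p , [ p∈ ]) = recompute (isElem? p) p∈
    where
    isElem? : (p : Pt n) → Dec (IsElem m p)
    isElem? (x , j) = (j ℕ.≤? m) ×-dec VAll.all? (ℕ._≤? j) x

  _≼?_ : Decidable (_≼_ {n} {m})
  a ≼? b = (proj₂ (value a) ℕ.≤? proj₂ (value b))
    ×-dec Pointwise.decidable ℕ._≤?_ (proj₁ (value a)) (proj₁ (value b))

  ≼-isPartialOrder : IsPartialOrder _≡_ (_≼_ {n} {m})
  ≼-isPartialOrder = record
    { isPreorder = record
      { isEquivalence = isEquivalence
      ; reflexive     = λ { refl → ⊑-refl }
      ; trans         = ⊑-trans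
      }
    ; antisym = λ a≼b b≼a → Refinementₚ.value-injective (⊑-antisym a≼b b≼a)
    }

  bot top : Elem n m
  bot = (replicate n 0 , 0) , [ z≤n , VAll-replicate n z≤n ]
  top = (replicate n m , m) , [ ℕₚ.≤-refl , VAll-replicate n ℕₚ.≤-refl ]

  bot-min : ∀ a → bot ≼ a
  bot-min a = z≤n , replicate-0-≤ᵛ _

  top-max : ∀ a → a ≼ top
  top-max a with Elem-IsElem a
  ... | j≤m , x≤j = j≤m , ≤ᵛ-replicate (VAll.map (λ u≤j → ℕₚ.≤-trans u≤j j≤m) x≤j)

  _⋖ᴱ_ : Rel (Elem n m) 0ℓ
  _⋖ᴱ_ = _⋖_ on value

  ⋖ᴱ-below : ∀ {a b} → a ≼ b × a ≢ b → ∃ λ a' → a ⋖ᴱ a' × a' ≼ b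
  ⋖ᴱ-below {a} {b} (a≼b , a≢b) with Elem-IsElem a | Elem-IsElem b
  ... | _ , a∈ | l≤m , b∈ with ⋖-below a≼b (a≢b ∘ Refinementₚ.value-injective) a∈ b∈
  ...   | a' , a⋖a' , a'⊑b , a'∈ = (a' , [ ℕₚ.≤-trans (proj₁ a'⊑b) l≤m , a'∈ ]) , a⋖a' , a'⊑b

  open Chains ≼-isPartialOrder (Refinementₚ._≟_ _≟ᴾ_) _≼?_
  open Graded _⋖ᴱ_ ⋖⇒⊑ (rank ∘ value) rank-⋖ (λ a≼b → Refinementₚ.value-injective ∘ ⊑-rank-antisym a≼b)
              ⋖ᴱ-below bot top bot-min top-max

  rank-bot : rank (value bot) ≡ 0
  rank-bot = trans (sum-replicate n 0) (*-zeroʳ n)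

  complement-saturated : ∀ {c} → Saturated c → ClosedWalk n m (List.map (complement ∘ value) c)
  complement-saturated (saturated {t = t} refl cov end) =
    closedWalk (map-∸-replicate n 0)
               (Allₚ.map⁺ (All.universal (λ e → complement-bounded {m = m} (Elem-IsElem e)) (bot ∷ t)))
               (Linkedₚ.map⁺ (Linked.map (λ {a} {b} → ⋖⇒Step (proj₂ (Elem-IsElem a)) (proj₂ (Elem-IsElem b)))
                                         cov))
               (trans (lastOr-map (complement ∘ value) bot t)
                      (trans (cong (complement ∘ value) end) (map-∸-replicate n m)))
               (trans (Listₚ.length-map _ t) length≡)
    where
    open ≡-Reasoning
    length≡ : length t ≡ suc n * m
    length≡ = begin
      length t                          ≡⟨ cong (_+ length t) (sym rank-bot) ⟩
      rank (value bot) + length t       ≡⟨ sym (Linked-height (rank ∘ value) rank-⋖ t cov) ⟩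
      rank (value (lastOr bot t))       ≡⟨ cong (rank ∘ value) end ⟩
      rank (value top)                  ≡⟨ rank-diagonal n m ⟩
      suc n * m                         ∎

  attach : (ps : List (Pt n)) → .(All (IsElem m) ps) → List (Elem n m)
  attach []       _   = []
  attach (p ∷ ps) ps∈ = (p , [ All.head ps∈ ]) ∷ attach ps (All.tail ps∈)

  map-value-attach : ∀ ps .(ps∈ : All (IsElem m) ps) → List.map value (attach ps ps∈) ≡ ps
  map-value-attach []       _   = refl
  map-value-attach (p ∷ ps) ps∈ = cong (p ∷_) (map-value-attach ps (All.tail ps∈))

  attach-map-value : ∀ ps .(ps∈ : All (IsElem m) ps) c → ps ≡ List.map value c → attach ps ps∈ ≡ c
  attach-map-value []       _   []      _  = refl
  attach-map-value (p ∷ ps) ps∈ (e ∷ c) eq =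
    cong₂ _∷_ (Refinementₚ.value-injective (Listₚ.∷-injectiveˡ eq))
              (attach-map-value ps (All.tail ps∈) c (Listₚ.∷-injectiveʳ eq))

  complement-chainOver : ∀ {l} → ClosedWalk n m l → List.map complement (chainOver l) ≡ l
  complement-chainOver (closedWalk refl _ steps _ _) =
    cong₂ _∷_ (map-∸-involutive (VAll-replicate n z≤n)) (complement-above steps (VAll-replicate n z≤n))

  chainOver-⋖ : ∀ {l} → ClosedWalk n m l → Linked _⋖_ (chainOver l)
  chainOver-⋖ (closedWalk refl _ steps _ _) = above-⋖ steps (VAll-replicate n z≤n)

  -- The end of the lifted chain has complement 0, so it is diagonal, and rank (n+1)m, so it is ⊤.
  chainOver-end : ∀ {w ws} → ClosedWalk n m (w ∷ ws) → lastOr (atLevel 0 w) (above 0 w ws) ≡ value top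
  chainOver-end {w} {ws} cw@(closedWalk refl _ _ end len) =
    complement-0⇒top (All-lastOr _ (chainOver-InLayer (w ∷ ws))) complement≡0 rank≡
    where
    open ≡-Reasoning
    ws-eq : complement (atLevel 0 w) ≡ w × List.map complement (above 0 w ws) ≡ ws
    ws-eq = Listₚ.∷-injective (complement-chainOver cw)
    complement≡0 : complement (lastOr (atLevel 0 w) (above 0 w ws)) ≡ replicate n 0
    complement≡0 = begin
      complement (lastOr (atLevel 0 w) (above 0 w ws))
        ≡⟨ sym (lastOr-map complement _ (above 0 w ws)) ⟩
      lastOr (complement (atLevel 0 w)) (List.map complement (above 0 w ws))
        ≡⟨ cong₂ lastOr (proj₁ ws-eq) (proj₂ ws-eq) ⟩
      lastOr w ws
        ≡⟨ end ⟩
      replicate n 0 ∎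
    rank≡ : rank (lastOr (atLevel 0 w) (above 0 w ws)) ≡ suc n * m
    rank≡ = begin
      rank (lastOr (atLevel 0 w) (above 0 w ws))
        ≡⟨ Linked-height rank rank-⋖ _ (chainOver-⋖ cw) ⟩
      rank (atLevel 0 w) + length (above 0 w ws)
        ≡⟨ cong₂ _+_ (cong sum (map-∸-replicate n 0))
                     (trans (sym (Listₚ.length-map complement (above 0 w ws))) (cong length (proj₂ ws-eq))) ⟩
      sum (replicate n 0) + length ws
        ≡⟨ cong (_+ length ws) rank-bot ⟩
      length ws
        ≡⟨ len ⟩
      suc n * m ∎

  chainOver-IsElem : ∀ {l} → ClosedWalk n m l → All (IsElem m) (chainOver l)
  chainOver-IsElem {w ∷ ws} cw = All.zipWith
    (λ (p⊑end , p∈) → ℕₚ.≤-trans (proj₁ p⊑end) (ℕₚ.≤-reflexive (cong proj₂ (chainOver-end cw))) , p∈)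
    (Linked-≤-lastOr ⊑-refl ⊑-trans _ (Linked.map ⋖⇒⊑ (chainOver-⋖ cw)) , chainOver-InLayer (w ∷ ws))

  chainOver-saturated : ∀ {l} (cw : ClosedWalk n m l) →
                        Saturated (attach (chainOver l) (chainOver-IsElem cw))
  chainOver-saturated {w ∷ ws} cw@(closedWalk refl _ _ _ _) = saturated
    (Refinementₚ.value-injective (cong (_, 0) (map-∸-replicate n 0)))
    (Linkedₚ.map⁻ (subst (Linked _⋖_) (sym (map-value-attach _ (chainOver-IsElem cw))) (chainOver-⋖ cw)))
    (Refinementₚ.value-injective (begin
      value (lastOr _ (attach (above 0 w ws) _))
        ≡⟨ sym (lastOr-map value _ (attach (above 0 w ws) _)) ⟩
      lastOr (atLevel 0 w) (List.map value (attach (above 0 w ws) _))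
        ≡⟨ cong (lastOr (atLevel 0 w)) (map-value-attach (above 0 w ws) _) ⟩
      lastOr (atLevel 0 w) (above 0 w ws)
        ≡⟨ chainOver-end cw ⟩
      value top ∎))
    where open ≡-Reasoning

  chainOver-complement : ∀ {c} → Saturated c →
                         chainOver (List.map (complement ∘ value) c) ≡ List.map value c
  chainOver-complement (saturated {t = t} refl cov _) = cong₂ _∷_
    (atLevel-complement (proj₂ (Elem-IsElem bot)))
    (trans (cong (above 0 _) (Listₚ.map-∘ t))
           (above-complement (Linkedₚ.map⁺ cov) (Allₚ.map⁺ (All.universal (proj₂ ∘ Elem-IsElem) (bot ∷ t)))))

  to : MaxChain n m → Walk n m
  to (c , [ c-max ]) =
    toWalk (List.map (complement ∘ value) c) (complement-saturated (maximal⇒saturated c-max))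

  from : Walk n m → MaxChain n m
  from (w , [ w-walk ]) = attach (chainOver (toList w)) (chainOver-IsElem (IsWalk⇒ClosedWalk w-walk))
                        , [ saturated⇒maximal (chainOver-saturated (IsWalk⇒ClosedWalk w-walk)) ]

  -- The walk and chain conditions are available only irrelevantly, but the equations they give
  -- are between lists over a type with decidable equality, so recompute recovers them.
  to∘from : ∀ w → to (from w) ≡ w
  to∘from (w , [ w-walk ]) = Refinementₚ.value-injective
    (trans (sym (Vecₚ.cast-is-id refl _)) (Vecₚ.toList-injective refl _ w (begin
      toList (value (to (from (w , [ w-walk ]))))
        ≡⟨ toList-cast-fromList (List.map (complement ∘ value) chain) _ ⟩
      List.map (complement ∘ value) chain
        ≡⟨ Listₚ.map-∘ chain ⟩
      List.map complement (List.map value chain)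
        ≡⟨ cong (List.map complement) (map-value-attach (chainOver (toList w)) _) ⟩
      List.map complement (chainOver (toList w))
        ≡⟨ recompute (Listₚ.≡-dec _≟ᵛ_ _ _) (complement-chainOver (IsWalk⇒ClosedWalk w-walk)) ⟩
      toList w ∎)))
    where
    open ≡-Reasoning
    chain : List (Elem n m)
    chain = value (from (w , [ w-walk ]))

  from∘to : ∀ c → from (to c) ≡ c
  from∘to (c , [ c-max ]) = Refinementₚ.value-injective (attach-map-value _ _ c (begin
    chainOver (toList (value (to (c , [ c-max ]))))
      ≡⟨ cong chainOver (toList-cast-fromList (List.map (complement ∘ value) c) _) ⟩
    chainOver (List.map (complement ∘ value) c)
      ≡⟨ recompute (Listₚ.≡-dec _≟ᴾ_ _ _) (chainOver-complement (maximal⇒saturated c-max)) ⟩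
    List.map value c ∎))
    where open ≡-Reasoning

theorem5p2 : (n m : ℕ) → MaxChain n m ⤖ Walk n m
theorem5p2 n m = ↔⇒⤖ (mk↔ₛ′ to from to∘from from∘to)
  where open SigmaPoset n m
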